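{- Let $\mathfrak A=\langle A,f,g\rangle$ be a PS-algebra. (a) If $\mathfrak A$ is a betweenness algebra, then for all $u,u_1,u_2,u_3\in\mathrm{Ult}(A)$: $Q_f(u,u,u)$; $Q_f(u_1,u_2,u_3)\to Q_f(u_3,u_2,u_1)$; $S_g(u_1,u_2,u_3)\to S_g(u_3,u_2,u_1)$; $Q_f(u_1,u_2,u_3)\to Q_f(u_1,u_1,u_2)$; and $Q_f(u_1,u_2,u_3)\wedge S_g(u_1,u_3,u_2)\to u_2=u_3$. (b) If $\mathfrak A$ is a strong betweenness algebra, then additionally $Q_f(u_1,u_1,u_2)$ for all $u_1,u_2$. (c) If $\mathfrak A$ is a weak betweenness algebra, then $S_g(u_1,u_2,u_1)\to u_1=u_2$ for all $u_1,u_2$.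
   Context: $A$ is a non-trivial Boolean algebra ($+,\cdot,-,0,1$); $\mathrm{Ult}(A)$ its set of ultrafilters. A PS-algebra has $f:A^2\to A$ normal and additive in each argument and $g:A^2\to A$ with $g(0,y)=g(x,0)=1$, $g(x+x',y)=g(x,y)\cdot g(x',y)$, $g(x,y+y')=g(x,y)\cdot g(x,y')$. $Q_f(u_1,u_2,u_3)$ iff $f[u_1\times u_3]\subseteq u_2$; $S_g(u_1,u_2,u_3)$ iff $g[u_1\times u_3]\cap u_2\ne\emptyset$. Axioms: (ABT0) $x\le f(x,x)$; (ABT1$_f$) $f(x,y)\le f(y,x)$; (ABT1$_g$) $g(x,y)\le g(y,x)$; (ABT2) $y\cdot f(x,z)\le f(x\cdot f(x,y),z)$; (ABT3) $f(x,g(x,-y)\cdot y)\le y$; (wMIA) $x,y\ne0\to g(x,y)\le f(x,y)$; (ABTW) $x\ne 0\to g(x,x)\le x$; (ABT2$^s$) $y\ne 0\to x\le f(x,y)$. Betweenness algebra: ABT0, ABT1$_f$, ABT1$_g$, ABT2, ABT3, wMIA. Weak: ABT0, ABT1$_f$, ABT1$_g$, ABT2, ABTW. Strong: a betweenness algebra satisfying ABT2$^s$. -}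

module Defs where

open import Level using (Level; _⊔_)
open import Algebra.Lattice.Bundles using (BooleanAlgebra)
open import Data.Product using (_×_; ∃-syntax; _,_)
open import Data.Sum using (_⊎_)
open import Relation.Nullary using (¬_)

module _ {c ℓ : Level} (B : BooleanAlgebra c ℓ) where
  open BooleanAlgebra B renaming (¬_ to -_)
  -- Boolean algebra notation: + is _∨_, · is _∧_, - is complement, 0 is ⊥, 1 is ⊤

  _≤_ : Carrier → Carrier → Set ℓ
  x ≤ y = (x ∧ y) ≈ x

  NonTrivial : Set ℓ
  NonTrivial = ¬ (⊥ ≈ ⊤)

  record Ultrafilter : Set (Level.suc (c ⊔ ℓ)) where
    field
      mem    : Carrier → Set (c ⊔ ℓ)
      ⊤∈     : mem ⊤
      ⊥∉     : ¬ mem ⊥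
      ∧-cl   : ∀ {x y} → mem x → mem y → mem (x ∧ y)
      up     : ∀ {x y} → mem x → x ≤ y → mem y
      ultra  : ∀ x → mem x ⊎ mem (- x)
  open Ultrafilter public

  _≐_ : Ultrafilter → Ultrafilter → Set (c ⊔ ℓ)
  u ≐ v = ∀ x → (mem u x → mem v x) × (mem v x → mem u x)

  record PSAlgebra : Set (c ⊔ ℓ) where
    field
      f g      : Carrier → Carrier → Carrier
      f-cong   : ∀ {x x' y y'} → x ≈ x' → y ≈ y' → f x y ≈ f x' y'
      g-cong   : ∀ {x x' y y'} → x ≈ x' → y ≈ y' → g x y ≈ g x' y'
      f-0l     : ∀ y → f ⊥ y ≈ ⊥
      f-0r     : ∀ x → f x ⊥ ≈ ⊥
      f-addl   : ∀ x x' y → f (x ∨ x') y ≈ (f x y ∨ f x' y)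
      f-addr   : ∀ x y y' → f x (y ∨ y') ≈ (f x y ∨ f x y')
      g-0l     : ∀ y → g ⊥ y ≈ ⊤
      g-0r     : ∀ x → g x ⊥ ≈ ⊤
      g-addl   : ∀ x x' y → g (x ∨ x') y ≈ (g x y ∧ g x' y)
      g-addr   : ∀ x y y' → g x (y ∨ y') ≈ (g x y ∧ g x y')

  module _ (P : PSAlgebra) where
    open PSAlgebra P

    Qf : Ultrafilter → Ultrafilter → Ultrafilter → Set (c ⊔ ℓ)
    Qf u₁ u₂ u₃ = ∀ x y → mem u₁ x → mem u₃ y → mem u₂ (f x y)

    Sg : Ultrafilter → Ultrafilter → Ultrafilter → Set (c ⊔ ℓ)
    Sg u₁ u₂ u₃ = ∃[ x ] ∃[ y ] (mem u₁ x × mem u₃ y × mem u₂ (g x y))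

    ABT0 ABT1f ABT1g ABT2 ABT3 wMIA ABTW ABT2s : Set (c ⊔ ℓ)
    ABT0  = ∀ x → x ≤ f x x
    ABT1f = ∀ x y → f x y ≤ f y x
    ABT1g = ∀ x y → g x y ≤ g y x
    ABT2  = ∀ x y z → (y ∧ f x z) ≤ f (x ∧ f x y) z
    ABT3  = ∀ x y → f x (g x (- y) ∧ y) ≤ y
    wMIA  = ∀ x y → ¬ (x ≈ ⊥) → ¬ (y ≈ ⊥) → g x y ≤ f x y
    ABTW  = ∀ x → ¬ (x ≈ ⊥) → g x x ≤ x
    ABT2s = ∀ x y → ¬ (y ≈ ⊥) → x ≤ f x y

    IsBetweenness : Set (c ⊔ ℓ)
    IsBetweenness = ABT0 × ABT1f × ABT1g × ABT2 × ABT3 × wMIA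

    IsWeakBetweenness : Set (c ⊔ ℓ)
    IsWeakBetweenness = ABT0 × ABT1f × ABT1g × ABT2 × ABTW

    IsStrongBetweenness : Set (c ⊔ ℓ)
    IsStrongBetweenness = IsBetweenness × ABT2s

-- Ultrafilters are up-closed, closed under meets and prime, while additivity makes f
-- monotone and g antitone in each argument; so each clause follows from a single axiom
-- applied to meets of members of the ultrafilters involved. For the two equalities of
-- ultrafilters one inclusion suffices, by maximality.
module Submission where

open import Defs hiding (_≤_)
open import Level using (Level)
open import Algebra.Lattice.Bundles using (BooleanAlgebra)
import Algebra.Lattice.Properties.BooleanAlgebra as BooleanAlgebraProperties
import Algebra.Lattice.Properties.Lattice as LatticeProperties
open import Data.Product using (_×_; _,_; swap)
open import Data.Sum using (inj₁; inj₂)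
open import Data.Empty using (⊥-elim)
open import Relation.Nullary using (¬_)
open import Relation.Binary.Core using (Rel)
open import Relation.Binary.Structures using (IsPartialOrder)
open import Relation.Binary.Bundles using (Poset)
import Relation.Binary.Lattice as OrderLattice
import Relation.Binary.Reasoning.PartialOrder as PartialOrderReasoning

module _ {c ℓ : Level} (B : BooleanAlgebra c ℓ) where
  open BooleanAlgebra B renaming (¬_ to -_)
  open BooleanAlgebraProperties B using (∧-zeroʳ; deMorgan₂; ¬-involutive)

  _≤_ : Rel Carrier ℓ
  _≤_ = Defs._≤_ B

  -- The library's natural order on a lattice is x ≈ x ∧ y, the symmetric form of _≤_.
  private
    module Natural = OrderLattice.IsLattice
      (LatticeProperties.∨-∧-isOrderTheoreticLattice lattice)

  ≤-isPartialOrder : IsPartialOrder _≈_ _≤_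
  ≤-isPartialOrder = record
    { isPreorder = record
      { isEquivalence = isEquivalence
      ; reflexive     = λ x≈y → sym (Natural.reflexive x≈y)
      ; trans         = λ x≤y y≤z → sym (Natural.trans (sym x≤y) (sym y≤z))
      }
    ; antisym = λ x≤y y≤x → Natural.antisym (sym x≤y) (sym y≤x)
    }

  ≤-poset : Poset c ℓ ℓ
  ≤-poset = record { isPartialOrder = ≤-isPartialOrder }

  open IsPartialOrder ≤-isPartialOrder public
    using () renaming (reflexive to ≤-reflexive; trans to ≤-trans)
  open PartialOrderReasoning ≤-poset

  x∧y≤x : ∀ x y → (x ∧ y) ≤ x
  x∧y≤x x y = sym (Natural.x∧y≤x x y)

  x∧y≤y : ∀ x y → (x ∧ y) ≤ y
  x∧y≤y x y = sym (Natural.x∧y≤y x y)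

  x≤x∨y : ∀ x y → x ≤ (x ∨ y)
  x≤x∨y x y = sym (Natural.x≤x∨y x y)

  ∧-mono : ∀ {x x' y y'} → x ≤ x' → y ≤ y' → (x ∧ y) ≤ (x' ∧ y')
  ∧-mono {x} {x'} {y} {y'} x≤x' y≤y' = sym (Natural.∧-greatest
    (sym (≤-trans (x∧y≤x x y) x≤x')) (sym (≤-trans (x∧y≤y x y) y≤y')))

  ≤⇒∨≈ : ∀ {x y} → x ≤ y → (x ∨ y) ≈ y
  ≤⇒∨≈ {x} {y} x∧y≈x = begin-equality
    x ∨ y        ≈⟨ ∨-congʳ x∧y≈x ⟨
    (x ∧ y) ∨ y  ≈⟨ ∨-comm (x ∧ y) y ⟩
    y ∨ (x ∧ y)  ≈⟨ ∨-congˡ (∧-comm x y) ⟩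
    y ∨ (y ∧ x)  ≈⟨ ∨-absorbs-∧ y x ⟩
    y            ∎

  ≤⊥⇒≈⊥ : ∀ {x} → x ≤ ⊥ → x ≈ ⊥
  ≤⊥⇒≈⊥ {x} x∧⊥≈x = trans (sym x∧⊥≈x) (∧-zeroʳ x)

  additive⇒monotone : (h : Carrier → Carrier) → (∀ {x y} → x ≈ y → h x ≈ h y) →
                      (∀ x y → h (x ∨ y) ≈ (h x ∨ h y)) →
                      ∀ {x y} → x ≤ y → h x ≤ h y
  additive⇒monotone h h-cong h-add {x} {y} x≤y = begin
    h x          ≤⟨ x≤x∨y (h x) (h y) ⟩
    h x ∨ h y    ≈⟨ h-add x y ⟨
    h (x ∨ y)    ≈⟨ h-cong (≤⇒∨≈ x≤y) ⟩
    h y          ∎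

  multiplicative⇒antitone : (h : Carrier → Carrier) → (∀ {x y} → x ≈ y → h x ≈ h y) →
                            (∀ x y → h (x ∨ y) ≈ (h x ∧ h y)) →
                            ∀ {x y} → x ≤ y → h y ≤ h x
  multiplicative⇒antitone h h-cong h-mul {x} {y} x≤y = begin
    h y          ≈⟨ h-cong (≤⇒∨≈ x≤y) ⟨
    h (x ∨ y)    ≈⟨ h-mul x y ⟩
    h x ∧ h y    ≤⟨ x∧y≤x (h x) (h y) ⟩
    h x          ∎

  module _ (u : Ultrafilter B) where

    mem-resp-≈ : ∀ {x y} → x ≈ y → mem u x → mem u y
    mem-resp-≈ x≈y x∈u = up u x∈u (≤-reflexive x≈y)

    mem⇒≉⊥ : ∀ {x} → mem u x → ¬ x ≈ ⊥
    mem⇒≉⊥ x∈u x≈⊥ = ⊥∉ u (mem-resp-≈ x≈⊥ x∈u)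

    mem⇒¬mem-¬ : ∀ {x} → mem u x → ¬ mem u (- x)
    mem⇒¬mem-¬ {x} x∈u -x∈u = mem⇒≉⊥ (∧-cl u x∈u -x∈u) (∧-complementʳ x)

    ¬mem-¬⇒mem : ∀ {x} → ¬ mem u (- x) → mem u x
    ¬mem-¬⇒mem {x} -x∉u with ultra u x
    ... | inj₁ x∈u  = x∈u
    ... | inj₂ -x∈u = ⊥-elim (-x∉u -x∈u)

  ⊆⇒≐ : (u v : Ultrafilter B) → (∀ x → mem u x → mem v x) → _≐_ B u v
  ⊆⇒≐ u v u⊆v x = u⊆v x , λ x∈v →
    ¬mem-¬⇒mem u λ -x∈u → mem⇒¬mem-¬ v x∈v (u⊆v (- x) -x∈u)

  ≐-sym : {u v : Ultrafilter B} → _≐_ B u v → _≐_ B v u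
  ≐-sym u≐v x = swap (u≐v x)

  module _ (P : PSAlgebra B) where
    open PSAlgebra P

    f-monoˡ : ∀ {x x'} y → x ≤ x' → f x y ≤ f x' y
    f-monoˡ y = additive⇒monotone (λ x → f x y) (λ x≈x' → f-cong x≈x' refl)
                                  (λ x x' → f-addl x x' y)

    f-monoʳ : ∀ x {y y'} → y ≤ y' → f x y ≤ f x y'
    f-monoʳ x = additive⇒monotone (f x) (f-cong refl) (f-addr x)

    g-antitoneˡ : ∀ {x x'} y → x ≤ x' → g x' y ≤ g x y
    g-antitoneˡ y = multiplicative⇒antitone (λ x → g x y) (λ x≈x' → g-cong x≈x' refl)
                                            (λ x x' → g-addl x x' y)

    g-antitoneʳ : ∀ x {y y'} → y ≤ y' → g x y' ≤ g x y
    g-antitoneʳ x = multiplicative⇒antitone (g x) (g-cong refl) (g-addr x)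

    ABT0⇒Qf-refl : ABT0 B P → (u : Ultrafilter B) → Qf B P u u u
    ABT0⇒Qf-refl abt0 u x y x∈u y∈u = up u (∧-cl u x∈u y∈u) (begin
      x ∧ y                ≤⟨ abt0 (x ∧ y) ⟩
      f (x ∧ y) (x ∧ y)    ≤⟨ f-monoˡ (x ∧ y) (x∧y≤x x y) ⟩
      f x (x ∧ y)          ≤⟨ f-monoʳ x (x∧y≤y x y) ⟩
      f x y                ∎)

    ABT1f⇒Qf-sym : ABT1f B P → (u₁ u₂ u₃ : Ultrafilter B) →
                   Qf B P u₁ u₂ u₃ → Qf B P u₃ u₂ u₁
    ABT1f⇒Qf-sym abt1f u₁ u₂ u₃ Q x y x∈u₃ y∈u₁ = up u₂ (Q y x y∈u₁ x∈u₃) (abt1f y x)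

    ABT1g⇒Sg-sym : ABT1g B P → (u₁ u₂ u₃ : Ultrafilter B) →
                   Sg B P u₁ u₂ u₃ → Sg B P u₃ u₂ u₁
    ABT1g⇒Sg-sym abt1g u₁ u₂ u₃ (x , y , x∈u₁ , y∈u₃ , gxy∈u₂) =
      y , x , y∈u₃ , x∈u₁ , up u₂ gxy∈u₂ (abt1g x y)

    -- If f x y ∉ u₁, then a = x ∧ - f x y ∈ u₁ has a ∧ f a y = ⊥, and ABT2 with z = ⊤
    -- puts f ⊥ ⊤ = ⊥ into u₂.
    ABT2⇒Qf-outer : ABT2 B P → (u₁ u₂ u₃ : Ultrafilter B) →
                    Qf B P u₁ u₂ u₃ → Qf B P u₁ u₁ u₂
    ABT2⇒Qf-outer abt2 u₁ u₂ u₃ Q x y x∈u₁ y∈u₂ = ¬mem-¬⇒mem u₁ λ -fxy∈u₁ →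
      let a∈u₁ = ∧-cl u₁ x∈u₁ -fxy∈u₁
          y∧fa⊤∈u₂ = ∧-cl u₂ y∈u₂ (Q a ⊤ a∈u₁ (⊤∈ u₃))
      in mem⇒≉⊥ u₂ (up u₂ y∧fa⊤∈u₂ (abt2 a y ⊤))
           (trans (f-cong a∧fay≈⊥ refl) (f-0l ⊤))
      where
      a : Carrier
      a = x ∧ - f x y

      a∧fay≈⊥ : (a ∧ f a y) ≈ ⊥
      a∧fay≈⊥ = ≤⊥⇒≈⊥ (begin
        a ∧ f a y             ≤⟨ ∧-mono (x∧y≤y x _) (f-monoˡ y (x∧y≤x x _)) ⟩
        - f x y ∧ f x y       ≈⟨ ∧-complementˡ (f x y) ⟩
        ⊥                     ∎)

    -- For z ∈ u₃ with - z ∈ u₂, ABT3 applied to v = z ∨ - y gives v ∈ u₂,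
    -- while - v = - z ∧ y ∈ u₂.
    ABT3⇒Qf-Sg-⊇ : ABT3 B P → (u₁ u₂ u₃ : Ultrafilter B) →
                   Qf B P u₁ u₂ u₃ → Sg B P u₁ u₃ u₂ → ∀ z → mem u₃ z → mem u₂ z
    ABT3⇒Qf-Sg-⊇ abt3 u₁ u₂ u₃ Q (x , y , x∈u₁ , y∈u₂ , gxy∈u₃) z z∈u₃ =
      ¬mem-¬⇒mem u₂ λ -z∈u₂ →
        let -v∈u₂ = mem-resp-≈ u₂ (sym -v≈-z∧y) (∧-cl u₂ -z∈u₂ y∈u₂)
            gx-v∈u₃ = up u₃ gxy∈u₃ (g-antitoneʳ x (≤-trans (≤-reflexive -v≈-z∧y)
                                                           (x∧y≤y (- z) y)))
            v∈u₃ = up u₃ z∈u₃ (x≤x∨y z (- y))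
            v∈u₂ = up u₂ (Q x _ x∈u₁ (∧-cl u₃ gx-v∈u₃ v∈u₃)) (abt3 x v)
        in mem⇒¬mem-¬ u₂ v∈u₂ -v∈u₂
      where
      v : Carrier
      v = z ∨ - y

      -v≈-z∧y : - v ≈ (- z ∧ y)
      -v≈-z∧y = trans (deMorgan₂ z (- y)) (∧-congˡ (¬-involutive y))

    ABT3⇒Qf-Sg-≐ : ABT3 B P → (u₁ u₂ u₃ : Ultrafilter B) →
                   Qf B P u₁ u₂ u₃ → Sg B P u₁ u₃ u₂ → _≐_ B u₂ u₃
    ABT3⇒Qf-Sg-≐ abt3 u₁ u₂ u₃ Q S =
      ≐-sym {u₃} {u₂} (⊆⇒≐ u₃ u₂ (ABT3⇒Qf-Sg-⊇ abt3 u₁ u₂ u₃ Q S))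

    ABT2s⇒Qf-outer : ABT2s B P → (u₁ u₂ : Ultrafilter B) → Qf B P u₁ u₁ u₂
    ABT2s⇒Qf-outer abt2s u₁ u₂ x y x∈u₁ y∈u₂ = up u₁ x∈u₁ (abt2s x y (mem⇒≉⊥ u₂ y∈u₂))

    ABTW⇒Sg-≐ : ABTW B P → (u₁ u₂ : Ultrafilter B) → Sg B P u₁ u₂ u₁ → _≐_ B u₁ u₂
    ABTW⇒Sg-≐ abtw u₁ u₂ (x , y , x∈u₁ , y∈u₁ , gxy∈u₂) = ⊆⇒≐ u₁ u₂ λ z z∈u₁ →
      let w = (x ∧ y) ∧ z
          w∈u₁ = ∧-cl u₁ (∧-cl u₁ x∈u₁ y∈u₁) z∈u₁
          w≤x∧y = x∧y≤x (x ∧ y) z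
      in up u₂ gxy∈u₂ (begin
        g x y   ≤⟨ g-antitoneˡ y (≤-trans w≤x∧y (x∧y≤x x y)) ⟩
        g w y   ≤⟨ g-antitoneʳ w (≤-trans w≤x∧y (x∧y≤y x y)) ⟩
        g w w   ≤⟨ abtw w (mem⇒≉⊥ u₁ w∈u₁) ⟩
        w       ≤⟨ x∧y≤y (x ∧ y) z ⟩
        z       ∎)

lemma7p2 : {c ℓ : Level} (B : BooleanAlgebra c ℓ) → NonTrivial B → (P : PSAlgebra B) →
    (IsBetweenness B P →
        ((u : Ultrafilter B) → Qf B P u u u)
      × ((u₁ u₂ u₃ : Ultrafilter B) → Qf B P u₁ u₂ u₃ → Qf B P u₃ u₂ u₁)
      × ((u₁ u₂ u₃ : Ultrafilter B) → Sg B P u₁ u₂ u₃ → Sg B P u₃ u₂ u₁)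
      × ((u₁ u₂ u₃ : Ultrafilter B) → Qf B P u₁ u₂ u₃ → Qf B P u₁ u₁ u₂)
      × ((u₁ u₂ u₃ : Ultrafilter B) → Qf B P u₁ u₂ u₃ → Sg B P u₁ u₃ u₂ → _≐_ B u₂ u₃))
  × (IsStrongBetweenness B P → (u₁ u₂ : Ultrafilter B) → Qf B P u₁ u₁ u₂)
  × (IsWeakBetweenness B P → (u₁ u₂ : Ultrafilter B) → Sg B P u₁ u₂ u₁ → _≐_ B u₁ u₂)
lemma7p2 B _ P =
    (λ (abt0 , abt1f , abt1g , abt2 , abt3 , _) →
        ABT0⇒Qf-refl B P abt0
      , ABT1f⇒Qf-sym B P abt1f
      , ABT1g⇒Sg-sym B P abt1g
      , ABT2⇒Qf-outer B P abt2
      , ABT3⇒Qf-Sg-≐ B P abt3)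
  , (λ (_ , abt2s) → ABT2s⇒Qf-outer B P abt2s)
  , (λ (_ , _ , _ , _ , abtw) → ABTW⇒Sg-≐ B P abtw)
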